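{- Let $(G,\tau)$ be an instance of RFTT in which $G$ is a tree. Then every feasible solution has average tour length at least \[L(G,\tau):=2\sum_{e\in E}\frac{c(e)}{q(e)}.\]
   Context: RFTT: an instance is $(G,\tau)$ with $G=(V\cup\{s\},E,c)$ a connected graph with depot $s$, nonnegative edge weights $c$, clients $V=\{v_1,\dots,v_n\}$ and turnover times $\tau\in\mathbb{N}^n$. A solution gives for each day $k\ge1$ a closed walk $T_k$ in $G$ from $s$ to $s$ and a set $J_k\subseteq V$ of clients on $T_k$ visited that day; it is feasible if for all $t\ge0$ and all $j$, $v_j\in\bigcup_{k=t+1}^{t+\tau_j}J_k$; solutions are periodic with some period $\ell$, and the average tour length is $\frac1\ell\sum_{k=1}^\ell c(T_k)$, where $c(T_k)$ is the total edge weight of $T_k$ with multiplicity. When $G$ is a tree, root it at $s$; for an edge $e$ let $D(e)$ be the set of vertices separated from $s$ by $e$ (the descendants of $e$), and define the tt-weight $q(e)=\min_{v_j\in D(e)}\tau_j$.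
   Formalization: The edge weights $c$ take values in the nonnegative rationals. -}

module Defs where

open import Data.Nat as ℕ using (ℕ; zero; suc; _⊓_; _≤_; _+_; NonZero)
open import Data.Fin using (Fin; zero; suc; toℕ; _≟_)
open import Data.List using (List; foldr)
open import Data.List.Base using (allFin)
open import Data.Bool using (Bool; true; false; if_then_else_; _∨_)
open import Data.Integer using (+_)
open import Data.Rational as ℚ using (ℚ; 0ℚ)
open import Data.Product using (∃; _×_; _,_)
open import Relation.Nullary.Decidable using (⌊_⌋)
open import Relation.Binary.PropositionalEquality using (_≡_)

-- A tree with depot s and n clients has vertex set Fin (suc n):
-- vertex zero is the depot s, vertex (suc j) is the client v_j.
-- The tree is given by a parent map: client j's parent is 'parent j',
-- whose index is strictly smaller than that of (suc j).  The edges are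
-- exactly e_j = {suc j , parent j} for j : Fin n (so edge e_j is
-- indexed by its lower endpoint, the client j).  Every tree rooted at
-- s can be presented this way (e.g. number vertices in BFS order).

record RootedTree (n : ℕ) : Set where
  field
    parent   : Fin n → Fin (suc n)
    parent<  : ∀ j → toℕ (parent j) ≤ toℕ j

Vertex : ℕ → Set
Vertex n = Fin (suc n)

depot : ∀ {n} → Vertex n
depot = zero

client : ∀ {n} → Fin n → Vertex n
client j = suc j

module _ {n : ℕ} (T : RootedTree n) where
  open RootedTree T

  data Step : Vertex n → Vertex n → Set where
    up   : ∀ j → Step (suc j) (parent j)
    down : ∀ j → Step (parent j) (suc j)

  stepEdge : ∀ {u v} → Step u v → Fin n
  stepEdge (up j)   = j
  stepEdge (down j) = j

  data Walk : Vertex n → Vertex n → Set where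
    []  : ∀ {u} → Walk u u
    _∷_ : ∀ {u v w} → Step u v → Walk v w → Walk u w

  data _∈W_ : ∀ {u w} → Vertex n → Walk u w → Set where
    here  : ∀ {u w} {p : Walk u w} → u ∈W p
    there : ∀ {x u v w} {s : Step u v} {p : Walk v w} → x ∈W p → x ∈W (s ∷ p)

  Tour : Set
  Tour = Walk depot depot

  walkCost : (c : Fin n → ℚ) → ∀ {u w} → Walk u w → ℚ
  walkCost c []       = 0ℚ
  walkCost c (s ∷ p)  = c (stepEdge s) ℚ.+ walkCost c p

  -- 'onPath fuel v i' : the client i lies on the path from v up to the
  -- depot (within 'fuel' parent steps).  Depth is at most n, so fuel n
  -- suffices.
  onPath : ℕ → Vertex n → Fin n → Bool
  onPath _          zero    i = false
  onPath zero       (suc j) i = ⌊ j ≟ i ⌋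
  onPath (suc fuel) (suc j) i = ⌊ j ≟ i ⌋ ∨ onPath fuel (parent j) i

  -- j ∈ D(e_i): client j is separated from s by the edge e_i,
  -- i.e. e_i lies on the path from v_j to s.
  inD : Fin n → Fin n → Bool
  inD i j = onPath n (suc j) i

  -- tt-weight q(e_i) = min_{v_j ∈ D(e_i)} τ_j  (D(e_i) ∋ v_i is nonempty).
  ttWeight : (τ : Fin n → ℕ) → Fin n → ℕ
  ttWeight τ i = foldr (λ j m → if inD i j then τ j ⊓ m else m) (τ i) (allFin n)

ΣFin : ∀ n → (Fin n → ℚ) → ℚ
ΣFin zero    f = 0ℚ
ΣFin (suc n) f = f zero ℚ.+ ΣFin n (λ i → f (suc i))

ΣDays : ℕ → (ℕ → ℚ) → ℚ
ΣDays zero    f = 0ℚ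
ΣDays (suc ℓ) f = ΣDays ℓ f ℚ.+ f (suc ℓ)

-- x / m for a natural number m; the m = 0 case never occurs in the
-- theorem (a feasible solution forces all τ_j ≥ 1, hence q(e) ≥ 1).
_÷ℕ_ : ℚ → ℕ → ℚ
x ÷ℕ zero  = 0ℚ
x ÷ℕ suc m = x ℚ.* (+ 1 ℚ./ suc m)

record Instance (n : ℕ) : Set where
  field
    tree   : RootedTree n
    c      : Fin n → ℚ
    c≥0    : ∀ j → 0ℚ ℚ.≤ c j
    τ      : Fin n → ℕ

module _ {n : ℕ} (I : Instance n) where
  open Instance I

  -- A periodic solution: for each day k ≥ 1 a tour T k and a set J k of
  -- clients (J k j ≡ true means v_j ∈ J_k), all clients of J k lying on
  -- T k; periodic with period ℓ ≥ 1.  (The values at k = 0 are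
  -- irrelevant.)
  record Solution : Set where
    field
      period      : ℕ
      period≢0    : NonZero period
      T           : ℕ → Tour tree
      J           : ℕ → Fin n → Bool
      J-on-T      : ∀ k j → J k j ≡ true → _∈W_ tree (client j) (T k)
      T-periodic  : ∀ k → T (k + period) ≡ T k
      J-periodic  : ∀ k j → J (k + period) j ≡ J k j

  Feasible : Solution → Set
  Feasible S = ∀ (t : ℕ) (j : Fin n) →
    ∃ λ k → (suc t ≤ k) × (k ≤ t + τ j) × (J k j ≡ true)
    where open Solution S

  averageTourLength : Solution → ℚ
  averageTourLength S =
    ΣDays period (λ k → walkCost tree c (T k)) ℚ.* ((+ 1 ℚ./ period) ⦃ period≢0 ⦄)
    where open Solution S

  lowerBound : ℚ
  lowerBound = + 2 ℚ./ 1 ℚ.* ΣFin n (λ i → c i ÷ℕ ttWeight tree τ i)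

module Submission where

-- Fix a feasible solution of period ℓ and an edge e.  Let w be a client
-- of D(e) with τ_w = q(e).  Feasibility serves w at least once in every
-- window of q(e) consecutive days; by periodicity w is therefore served
-- on at least ℓ/q(e) of the days 1..ℓ.  On each such day the tour, a
-- closed walk from the depot, enters D(e) and so traverses e at least
-- twice.  Since the length of a walk is Σ_e c(e)·(traversals of e), the
-- total length of the tours T_1..T_ℓ is at least Σ_e c(e)·2ℓ/q(e) = ℓ·L.

open import Defs
open import Data.Nat using (ℕ)

module DayCounting where
  open import Data.Nat
  open import Data.Nat.Properties
  open import Data.Bool using (Bool; true; false)
  open import Data.Product using (∃; _×_; _,_)
  open import Relation.Binary.PropositionalEquality

  ΣDaysℕ : ℕ → (ℕ → ℕ) → ℕ
  ΣDaysℕ zero    f = 0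
  ΣDaysℕ (suc a) f = ΣDaysℕ a f + f (suc a)

  indicator : Bool → ℕ
  indicator true  = 1
  indicator false = 0

  daysWith : (ℕ → Bool) → ℕ → ℕ
  daysWith b a = ΣDaysℕ a (λ k → indicator (b k))

  Recurrent : ℕ → (ℕ → Bool) → Set
  Recurrent τ b = ∀ t → ∃ λ k → (suc t ≤ k) × (k ≤ t + τ) × (b k ≡ true)

  Periodic : ∀ {A : Set} → ℕ → (ℕ → A) → Set
  Periodic ℓ f = ∀ k → f (k + ℓ) ≡ f k

  ΣDaysℕ-cong : ∀ a {f g : ℕ → ℕ} → (∀ k → f k ≡ g k) → ΣDaysℕ a f ≡ ΣDaysℕ a g
  ΣDaysℕ-cong zero    f≡g = refl
  ΣDaysℕ-cong (suc a) f≡g = cong₂ _+_ (ΣDaysℕ-cong a f≡g) (f≡g (suc a))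

  ΣDaysℕ-mono : ∀ a {f g : ℕ → ℕ} → (∀ k → f k ≤ g k) → ΣDaysℕ a f ≤ ΣDaysℕ a g
  ΣDaysℕ-mono zero    f≤g = z≤n
  ΣDaysℕ-mono (suc a) f≤g = +-mono-≤ (ΣDaysℕ-mono a f≤g) (f≤g (suc a))

  ΣDaysℕ-scale : ∀ a m (f : ℕ → ℕ) → ΣDaysℕ a (λ k → m * f k) ≡ m * ΣDaysℕ a f
  ΣDaysℕ-scale zero    m f = sym (*-zeroʳ m)
  ΣDaysℕ-scale (suc a) m f =
    trans (cong (_+ m * f (suc a)) (ΣDaysℕ-scale a m f)) (sym (*-distribˡ-+ m _ _))

  ΣDaysℕ-split : ∀ x y (f : ℕ → ℕ) → ΣDaysℕ (x + y) f ≡ ΣDaysℕ x f + ΣDaysℕ y (λ k → f (x + k))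
  ΣDaysℕ-split x zero    f = trans (cong (λ z → ΣDaysℕ z f) (+-identityʳ x)) (sym (+-identityʳ _))
  ΣDaysℕ-split x (suc y) f = begin
    ΣDaysℕ (x + suc y) f                                   ≡⟨ cong (λ z → ΣDaysℕ z f) (+-suc x y) ⟩
    ΣDaysℕ (x + y) f + f (suc (x + y))                     ≡⟨ cong (_+ f (suc (x + y))) (ΣDaysℕ-split x y f) ⟩
    ΣDaysℕ x f + ΣDaysℕ y (λ k → f (x + k)) + f (suc (x + y))
      ≡⟨ +-assoc (ΣDaysℕ x f) _ _ ⟩
    ΣDaysℕ x f + (ΣDaysℕ y (λ k → f (x + k)) + f (suc (x + y)))
      ≡⟨ cong (λ z → ΣDaysℕ x f + (ΣDaysℕ y (λ k → f (x + k)) + f z)) (sym (+-suc x y)) ⟩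
    ΣDaysℕ x f + ΣDaysℕ (suc y) (λ k → f (x + k))          ∎
    where open ≡-Reasoning

  ΣDaysℕ-extend : ∀ {x y} (f : ℕ → ℕ) → x ≤ y → ΣDaysℕ x f ≤ ΣDaysℕ y f
  ΣDaysℕ-extend {x} {y} f x≤y = begin
    ΣDaysℕ x f                                        ≤⟨ m≤m+n _ _ ⟩
    ΣDaysℕ x f + ΣDaysℕ (y ∸ x) (λ k → f (x + k))     ≡⟨ sym (ΣDaysℕ-split x (y ∸ x) f) ⟩
    ΣDaysℕ (x + (y ∸ x)) f                            ≡⟨ cong (λ z → ΣDaysℕ z f) (m+[n∸m]≡n x≤y) ⟩
    ΣDaysℕ y f                                        ∎
    where open ≤-Reasoning

  ΣDaysℕ-periodic : ∀ ℓ (f : ℕ → ℕ) → Periodic ℓ f → ∀ m → ΣDaysℕ (m * ℓ) f ≡ m * ΣDaysℕ ℓ f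
  ΣDaysℕ-periodic ℓ f per zero    = refl
  ΣDaysℕ-periodic ℓ f per (suc m) = begin
    ΣDaysℕ (ℓ + m * ℓ) f                                ≡⟨ cong (λ z → ΣDaysℕ z f) (+-comm ℓ (m * ℓ)) ⟩
    ΣDaysℕ (m * ℓ + ℓ) f                                ≡⟨ ΣDaysℕ-split (m * ℓ) ℓ f ⟩
    ΣDaysℕ (m * ℓ) f + ΣDaysℕ ℓ (λ k → f (m * ℓ + k))   ≡⟨ cong₂ _+_ (ΣDaysℕ-periodic ℓ f per m)
                                                                     (ΣDaysℕ-cong ℓ (shift m)) ⟩
    m * ΣDaysℕ ℓ f + ΣDaysℕ ℓ f                         ≡⟨ +-comm (m * ΣDaysℕ ℓ f) _ ⟩
    ΣDaysℕ ℓ f + m * ΣDaysℕ ℓ f                         ∎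
    where
    open ≡-Reasoning
    shift : ∀ m k → f (m * ℓ + k) ≡ f k
    shift zero    k = refl
    shift (suc m) k = begin
      f (ℓ + m * ℓ + k)   ≡⟨ cong f (trans (+-assoc ℓ (m * ℓ) k) (+-comm ℓ (m * ℓ + k))) ⟩
      f (m * ℓ + k + ℓ)   ≡⟨ per (m * ℓ + k) ⟩
      f (m * ℓ + k)       ≡⟨ shift m k ⟩
      f k                 ∎

  daysWith-hit : ∀ b {t k a} → b k ≡ true → suc t ≤ k → k ≤ a → suc (daysWith b t) ≤ daysWith b a
  daysWith-hit b {t} {suc k} {a} bk (s≤s t≤k) k≤a = begin
    suc (daysWith b t)                     ≤⟨ s≤s (ΣDaysℕ-extend _ t≤k) ⟩
    suc (daysWith b k)                     ≡⟨ +-comm 1 (daysWith b k) ⟩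
    daysWith b k + 1                       ≡⟨ cong (λ x → daysWith b k + indicator x) (sym bk) ⟩
    daysWith b (suc k)                     ≤⟨ ΣDaysℕ-extend _ k≤a ⟩
    daysWith b a                           ∎
    where open ≤-Reasoning

  -- The first m windows of length τ each contain a day with b.
  recurrent-count : ∀ τ b → Recurrent τ b → ∀ m → m ≤ daysWith b (m * τ)
  recurrent-count τ b rec zero    = z≤n
  recurrent-count τ b rec (suc m) with rec (m * τ)
  ... | k , mτ<k , k≤mτ+τ , bk = begin
    suc m                          ≤⟨ s≤s (recurrent-count τ b rec m) ⟩
    suc (daysWith b (m * τ))       ≤⟨ daysWith-hit b bk mτ<k k≤mτ+τ ⟩
    daysWith b (m * τ + τ)         ≡⟨ cong (daysWith b) (+-comm (m * τ) τ) ⟩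
    daysWith b (suc m * τ)         ∎
    where open ≤-Reasoning

  recurrent-periodic-count : ∀ τ ℓ b → Recurrent τ b → Periodic ℓ b → ℓ ≤ daysWith b ℓ * τ
  recurrent-periodic-count τ ℓ b rec per = begin
    ℓ                          ≤⟨ recurrent-count τ b rec ℓ ⟩
    daysWith b (ℓ * τ)         ≡⟨ cong (daysWith b) (*-comm ℓ τ) ⟩
    daysWith b (τ * ℓ)         ≡⟨ ΣDaysℕ-periodic ℓ (λ k → indicator (b k)) (λ k → cong indicator (per k)) τ ⟩
    τ * daysWith b ℓ           ≡⟨ *-comm τ (daysWith b ℓ) ⟩
    daysWith b ℓ * τ           ∎
    where open ≤-Reasoning

module NatInℚ where
  open import Data.Nat as ℕ using (ℕ; zero; suc; NonZero)
  import Data.Nat.Properties as ℕₚ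
  import Data.Nat.Coprimality as Coprime
  open import Data.Integer as ℤ using (+_)
  open import Data.Rational using (ℚ; mkℚ; 0ℚ; 1ℚ; _+_; _*_; _≤_; _/_; toℚᵘ; NonNegative; nonNegative)
  open import Data.Rational.Properties
  import Data.Rational.Unnormalised as ℚᵘ
  import Data.Rational.Unnormalised.Properties as ℚᵘ
  open import Data.Rational.Solver using (module +-*-Solver)
  open +-*-Solver using (solve; _:=_; _:*_)
  open import Relation.Binary.PropositionalEquality

  -- m ↦ m/1, written directly in normal form.
  toℚ : ℕ → ℚ
  toℚ m = mkℚ (+ m) 0 (Coprime.sym (Coprime.1-coprimeTo m))

  -- The only step that has to look at representations: compare the
  -- unnormalised sum 1/1 + m/1 with (1+m)/1 by cross-multiplication.
  toℚ-suc : ∀ m → toℚ (suc m) ≡ 1ℚ + toℚ m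
  toℚ-suc m = toℚᵘ-injective (ℚᵘ.≃-sym (ℚᵘ.≃-trans (toℚᵘ-homo-+ 1ℚ (toℚ m)) (ℚᵘ.*≡* (cross m))))
    where
    cross : ∀ m → ℚᵘ.↥ (toℚᵘ 1ℚ ℚᵘ.+ toℚᵘ (toℚ m)) ℤ.* ℚᵘ.↧ toℚᵘ (toℚ (suc m))
                ≡ ℚᵘ.↥ toℚᵘ (toℚ (suc m)) ℤ.* ℚᵘ.↧ (toℚᵘ 1ℚ ℚᵘ.+ toℚᵘ (toℚ m))
    cross zero    = refl
    cross (suc m) = cong (λ x → + suc (suc x)) (ℕₚ.*-identityʳ _)

  toℚ-+ : ∀ a b → toℚ (a ℕ.+ b) ≡ toℚ a + toℚ b
  toℚ-+ zero    b = sym (+-identityˡ (toℚ b))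
  toℚ-+ (suc a) b = begin
    toℚ (suc (a ℕ.+ b))      ≡⟨ toℚ-suc (a ℕ.+ b) ⟩
    1ℚ + toℚ (a ℕ.+ b)       ≡⟨ cong (λ x → 1ℚ + x) (toℚ-+ a b) ⟩
    1ℚ + (toℚ a + toℚ b)     ≡⟨ sym (+-assoc 1ℚ (toℚ a) (toℚ b)) ⟩
    1ℚ + toℚ a + toℚ b       ≡⟨ cong (_+ toℚ b) (sym (toℚ-suc a)) ⟩
    toℚ (suc a) + toℚ b      ∎
    where open ≡-Reasoning

  toℚ-* : ∀ a b → toℚ (a ℕ.* b) ≡ toℚ a * toℚ b
  toℚ-* zero    b = sym (*-zeroˡ (toℚ b))
  toℚ-* (suc a) b = begin
    toℚ (b ℕ.+ a ℕ.* b)          ≡⟨ toℚ-+ b (a ℕ.* b) ⟩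
    toℚ b + toℚ (a ℕ.* b)        ≡⟨ cong (λ x → toℚ b + x) (toℚ-* a b) ⟩
    toℚ b + toℚ a * toℚ b        ≡⟨ cong (_+ toℚ a * toℚ b) (sym (*-identityˡ (toℚ b))) ⟩
    1ℚ * toℚ b + toℚ a * toℚ b   ≡⟨ sym (*-distribʳ-+ (toℚ b) 1ℚ (toℚ a)) ⟩
    (1ℚ + toℚ a) * toℚ b         ≡⟨ cong (_* toℚ b) (sym (toℚ-suc a)) ⟩
    toℚ (suc a) * toℚ b          ∎
    where open ≡-Reasoning

  toℚ-mono : ∀ {a b} → a ℕ.≤ b → toℚ a ≤ toℚ b
  toℚ-mono {a} {b} a≤b = begin
    toℚ a                    ≡⟨ sym (+-identityʳ (toℚ a)) ⟩
    toℚ a + 0ℚ               ≤⟨ +-monoʳ-≤ (toℚ a) (nonNegative⁻¹ (toℚ (b ℕ.∸ a))) ⟩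
    toℚ a + toℚ (b ℕ.∸ a)    ≡⟨ sym (toℚ-+ a (b ℕ.∸ a)) ⟩
    toℚ (a ℕ.+ (b ℕ.∸ a))    ≡⟨ cong toℚ (ℕₚ.m+[n∸m]≡n a≤b) ⟩
    toℚ b                    ∎
    where open ≤-Reasoning

  toℚ-inverse : ∀ m ⦃ _ : NonZero m ⦄ → toℚ m * (+ 1 / m) ≡ 1ℚ
  toℚ-inverse (suc q) =
    trans (cong (toℚ (suc q) *_) (normalize-coprime {1} {q} (Coprime.1-coprimeTo (suc q))))
          (*-inverseʳ (toℚ (suc q)))

  -- An integral inequality a ≤ q·b yields the rational one a·(c/q) ≤ c·b
  -- for every c ≥ 0.  (For q = 0 the left side is 0, as c ÷ℕ 0 = 0.)
  ÷ℕ-bound : ∀ c → 0ℚ ≤ c → ∀ a q b → a ℕ.≤ q ℕ.* b → toℚ a * (c ÷ℕ q) ≤ c * toℚ b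
  ÷ℕ-bound c c≥0 a zero b _ = begin
    toℚ a * 0ℚ   ≡⟨ *-zeroʳ (toℚ a) ⟩
    0ℚ           ≤⟨ nonNegative⁻¹ (c * toℚ b) ⦃ nonNeg*nonNeg⇒nonNeg c ⦃ nonNegative c≥0 ⦄ (toℚ b) ⦄ ⟩
    c * toℚ b    ∎
    where open ≤-Reasoning
  ÷ℕ-bound c c≥0 a (suc q) b a≤qb = begin
    toℚ a * (c * r)                      ≤⟨ *-monoʳ-≤-nonNeg (c * r) ⦃ c*r≥0 ⦄ (toℚ-mono a≤qb) ⟩
    toℚ (suc q ℕ.* b) * (c * r)          ≡⟨ cong (_* (c * r)) (toℚ-* (suc q) b) ⟩
    toℚ (suc q) * toℚ b * (c * r)        ≡⟨ regroup (toℚ (suc q)) (toℚ b) c r ⟩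
    c * toℚ b * (toℚ (suc q) * r)        ≡⟨ cong (c * toℚ b *_) (toℚ-inverse (suc q)) ⟩
    c * toℚ b * 1ℚ                       ≡⟨ *-identityʳ (c * toℚ b) ⟩
    c * toℚ b                            ∎
    where
    open ≤-Reasoning
    r : ℚ
    r = + 1 / suc q
    c*r≥0 : NonNegative (c * r)
    c*r≥0 = nonNeg*nonNeg⇒nonNeg c ⦃ nonNegative c≥0 ⦄ r ⦃ normalize-nonNeg 1 (suc q) ⦄
    regroup : ∀ x y z w → x * y * (z * w) ≡ z * y * (x * w)
    regroup = solve 4 (λ x y z w → x :* y :* (z :* w) := z :* y :* (x :* w)) refl

  divide-bound : ∀ ℓ ⦃ _ : NonZero ℓ ⦄ a X → toℚ ℓ * a ≤ X → a ≤ X * (+ 1 / ℓ)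
  divide-bound ℓ a X ℓa≤X = begin
    a                          ≡⟨ sym (*-identityʳ a) ⟩
    a * 1ℚ                     ≡⟨ cong (a *_) (sym (toℚ-inverse ℓ)) ⟩
    a * (toℚ ℓ * (+ 1 / ℓ))    ≡⟨ regroup a (toℚ ℓ) (+ 1 / ℓ) ⟩
    toℚ ℓ * a * (+ 1 / ℓ)      ≤⟨ *-monoʳ-≤-nonNeg (+ 1 / ℓ) ⦃ normalize-nonNeg 1 ℓ ⦄ ℓa≤X ⟩
    X * (+ 1 / ℓ)              ∎
    where
    open ≤-Reasoning
    regroup : ∀ x y z → x * (y * z) ≡ y * x * z
    regroup = solve 3 (λ x y z → x :* (y :* z) := y :* x :* z) refl

module Sums where
  open import Data.Nat using (ℕ; zero; suc)
  open import Data.Fin using (Fin; zero; suc)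
  open import Data.Fin.Properties using (suc-injective)
  open import Data.Rational using (ℚ; 0ℚ; _+_; _*_; _≤_)
  open import Data.Rational.Properties
  open import Data.Rational.Solver using (module +-*-Solver)
  open +-*-Solver using (solve; _:=_; _:+_)
  open import Relation.Nullary using (¬_)
  open import Relation.Binary.PropositionalEquality
  open DayCounting using (ΣDaysℕ)
  open NatInℚ using (toℚ; toℚ-+)

  ΣFin-cong : ∀ n {f g : Fin n → ℚ} → (∀ i → f i ≡ g i) → ΣFin n f ≡ ΣFin n g
  ΣFin-cong zero    f≡g = refl
  ΣFin-cong (suc n) f≡g = cong₂ _+_ (f≡g zero) (ΣFin-cong n (λ i → f≡g (suc i)))

  ΣFin-mono : ∀ n {f g : Fin n → ℚ} → (∀ i → f i ≤ g i) → ΣFin n f ≤ ΣFin n g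
  ΣFin-mono zero    f≤g = ≤-refl
  ΣFin-mono (suc n) f≤g = +-mono-≤ (f≤g zero) (ΣFin-mono n (λ i → f≤g (suc i)))

  ΣFin-zero : ∀ n {f : Fin n → ℚ} → (∀ i → f i ≡ 0ℚ) → ΣFin n f ≡ 0ℚ
  ΣFin-zero zero    f≡0 = refl
  ΣFin-zero (suc n) f≡0 = cong₂ _+_ (f≡0 zero) (ΣFin-zero n (λ i → f≡0 (suc i)))

  ΣFin-+ : ∀ n (f g : Fin n → ℚ) → ΣFin n (λ i → f i + g i) ≡ ΣFin n f + ΣFin n g
  ΣFin-+ zero    f g = refl
  ΣFin-+ (suc n) f g =
    trans (cong (f zero + g zero +_) (ΣFin-+ n (λ i → f (suc i)) (λ i → g (suc i))))
          (interchange (f zero) (g zero) _ _)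
    where
    interchange : ∀ a b c d → (a + b) + (c + d) ≡ (a + c) + (b + d)
    interchange = solve 4 (λ a b c d → (a :+ b) :+ (c :+ d) := (a :+ c) :+ (b :+ d)) refl

  ΣFin-single : ∀ n (f : Fin n → ℚ) (j : Fin n) → (∀ i → ¬ i ≡ j → f i ≡ 0ℚ) → ΣFin n f ≡ f j
  ΣFin-single (suc n) f zero    f≡0 =
    trans (cong (f zero +_) (ΣFin-zero n (λ i → f≡0 (suc i) (λ ()))))
          (+-identityʳ (f zero))
  ΣFin-single (suc n) f (suc j) f≡0 =
    trans (cong₂ _+_ (f≡0 zero (λ ()))
                     (ΣFin-single n (λ i → f (suc i)) j (λ i i≢j → f≡0 (suc i) (i≢j ∘ suc-injective))))
          (+-identityˡ (f (suc j)))
    where open import Function using (_∘_)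

  ΣFin-scale : ∀ n (a : ℚ) (f : Fin n → ℚ) → ΣFin n (λ i → a * f i) ≡ a * ΣFin n f
  ΣFin-scale zero    a f = sym (*-zeroʳ a)
  ΣFin-scale (suc n) a f =
    trans (cong (a * f zero +_) (ΣFin-scale n a (λ i → f (suc i))))
          (sym (*-distribˡ-+ a (f zero) _))

  ΣDays-cong : ∀ ℓ {f g : ℕ → ℚ} → (∀ k → f k ≡ g k) → ΣDays ℓ f ≡ ΣDays ℓ g
  ΣDays-cong zero    f≡g = refl
  ΣDays-cong (suc ℓ) f≡g = cong₂ _+_ (ΣDays-cong ℓ f≡g) (f≡g (suc ℓ))

  ΣDays-ΣFin : ∀ ℓ n (F : ℕ → Fin n → ℚ) →
    ΣDays ℓ (λ k → ΣFin n (F k)) ≡ ΣFin n (λ i → ΣDays ℓ (λ k → F k i))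
  ΣDays-ΣFin zero    n F = sym (ΣFin-zero n (λ i → refl))
  ΣDays-ΣFin (suc ℓ) n F =
    trans (cong (_+ ΣFin n (F (suc ℓ))) (ΣDays-ΣFin ℓ n F))
          (sym (ΣFin-+ n (λ i → ΣDays ℓ (λ k → F k i)) (F (suc ℓ))))

  ΣDays-toℚ : ∀ ℓ (a : ℚ) (f : ℕ → ℕ) → ΣDays ℓ (λ k → a * toℚ (f k)) ≡ a * toℚ (ΣDaysℕ ℓ f)
  ΣDays-toℚ zero    a f = sym (*-zeroʳ a)
  ΣDays-toℚ (suc ℓ) a f = begin
    ΣDays ℓ (λ k → a * toℚ (f k)) + a * toℚ (f (suc ℓ))   ≡⟨ cong (_+ a * toℚ (f (suc ℓ))) (ΣDays-toℚ ℓ a f) ⟩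
    a * toℚ (ΣDaysℕ ℓ f) + a * toℚ (f (suc ℓ))           ≡⟨ sym (*-distribˡ-+ a _ _) ⟩
    a * (toℚ (ΣDaysℕ ℓ f) + toℚ (f (suc ℓ)))             ≡⟨ cong (a *_) (sym (toℚ-+ (ΣDaysℕ ℓ f) _)) ⟩
    a * toℚ (ΣDaysℕ (suc ℓ) f)                           ∎
    where open ≡-Reasoning

module DecidableTests where
  open import Data.Bool using (true; false)
  open import Relation.Nullary using (Dec; ¬_)
  open import Relation.Nullary.Decidable using (⌊_⌋; isYes≗does; dec-true; dec-false)
  open import Relation.Binary.PropositionalEquality using (_≡_; trans)

  ⌊⌋-true : ∀ {A : Set} (a? : Dec A) → A → ⌊ a? ⌋ ≡ true
  ⌊⌋-true a? a = trans (isYes≗does a?) (dec-true a? a)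

  ⌊⌋-false : ∀ {A : Set} (a? : Dec A) → ¬ A → ⌊ a? ⌋ ≡ false
  ⌊⌋-false a? ¬a = trans (isYes≗does a?) (dec-false a? ¬a)

-- For a client edge e_i, 'beyond i v'
-- decides v ∈ D(e_i), i.e. whether e_i lies on the path from v to the
-- depot.  It satisfies beyond i v_j = (j = i) ∨ beyond i (parent j), and
-- the parent of v_i is not beyond e_i; hence a step of a walk changes
-- sides exactly when it traverses e_i.  Consequently a closed walk from
-- the depot through a vertex of D(e_i) traverses e_i at least twice.
module TreeCrossings {n : ℕ} (T : RootedTree n) where
  open import Data.Nat using (ℕ; zero; suc; _≤_; _<_; _+_; z≤n; s≤s)
  open import Data.Nat.Properties using (≤-trans; <⇒≤; n≤1+n)
  open import Data.Fin using (Fin; zero; suc; toℕ; _≟_)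
  open import Data.Fin.Properties using (toℕ<n; <⇒≢)
  open import Data.Bool using (Bool; true; false; _∨_; not)
  open import Data.Bool.Properties using (∨-identityʳ)
  open import Relation.Nullary using (¬_; yes; no; contradiction)
  open import Relation.Nullary.Decidable using (⌊_⌋)
  open import Relation.Binary.PropositionalEquality
  open DayCounting using (indicator)
  open DecidableTests using (⌊⌋-true; ⌊⌋-false)
  open RootedTree T

  -- Parents have smaller indices, so e_i (whose lower endpoint v_i has
  -- index toℕ i + 1) lies on no path upward from a vertex of index ≤ toℕ i.
  onPath-false : ∀ f v i → toℕ v ≤ toℕ i → onPath T f v i ≡ false
  onPath-false f       zero    i _     = refl
  onPath-false zero    (suc j) i j<i   = ⌊⌋-false (j ≟ i) (<⇒≢ j<i)
  onPath-false (suc f) (suc j) i j<i   =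
    cong₂ _∨_ (⌊⌋-false (j ≟ i) (<⇒≢ j<i))
              (onPath-false f (parent j) i (≤-trans (parent< j) (<⇒≤ j<i)))

  onPath-stable : ∀ f v i → toℕ v ≤ suc f → onPath T f v i ≡ onPath T (suc f) v i
  onPath-stable f       zero    i _ = refl
  onPath-stable zero    (suc j) i (s≤s j≤0) =
    sym (trans (cong (⌊ j ≟ i ⌋ ∨_) (onPath-false zero (parent j) i (≤-trans (parent< j) (≤-trans j≤0 z≤n))))
               (∨-identityʳ _))
  onPath-stable (suc f) (suc j) i (s≤s j≤f) =
    cong (⌊ j ≟ i ⌋ ∨_) (onPath-stable f (parent j) i (≤-trans (parent< j) j≤f))

  beyond : Fin n → Vertex n → Bool
  beyond i v = onPath T n v i

  beyond-suc : ∀ i j → beyond i (suc j) ≡ ⌊ j ≟ i ⌋ ∨ beyond i (parent j)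
  beyond-suc i j = unfold n (toℕ<n j)
    where
    unfold : ∀ f → toℕ j < f → onPath T f (suc j) i ≡ ⌊ j ≟ i ⌋ ∨ onPath T f (parent j) i
    unfold (suc f) (s≤s j≤f) =
      cong (⌊ j ≟ i ⌋ ∨_) (onPath-stable f (parent j) i (≤-trans (parent< j) (≤-trans j≤f (n≤1+n f))))

  beyond-self : ∀ i → beyond i (suc i) ≡ true
  beyond-self i = trans (beyond-suc i i) (cong (_∨ beyond i (parent i)) (⌊⌋-true (i ≟ i) refl))

  beyond-parent : ∀ i → beyond i (parent i) ≡ false
  beyond-parent i = onPath-false n (parent i) i (parent< i)

  step-stays : ∀ i {u v} (s : Step T u v) → ¬ stepEdge T s ≡ i → beyond i u ≡ beyond i v
  step-stays i (up j)   j≢i = trans (beyond-suc i j) (cong (_∨ beyond i (parent j)) (⌊⌋-false (j ≟ i) j≢i))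
  step-stays i (down j) j≢i = sym (step-stays i (up j) j≢i)

  step-switches : ∀ i {u v} (s : Step T u v) → stepEdge T s ≡ i → beyond i v ≡ not (beyond i u)
  step-switches i (up .i)   refl = trans (beyond-parent i) (cong not (sym (beyond-self i)))
  step-switches i (down .i) refl = trans (beyond-self i) (cong not (sym (beyond-parent i)))

  crossings : Fin n → ∀ {u w} → Walk T u w → ℕ
  crossings i []      = 0
  crossings i (s ∷ p) = indicator ⌊ stepEdge T s ≟ i ⌋ + crossings i p

  crosses-once : ∀ i {u w} (p : Walk T u w) → ¬ beyond i u ≡ beyond i w → 1 ≤ crossings i p
  crosses-once i []      u≢w = contradiction refl u≢w
  crosses-once i (s ∷ p) u≢w with stepEdge T s ≟ i
  ... | yes _   = s≤s z≤n
  ... | no  s≢i = crosses-once i p (λ v≡w → u≢w (trans (step-stays i s s≢i) v≡w))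

  crosses-twice : ∀ i {x u w} (p : Walk T u w) → _∈W_ T x p →
    beyond i u ≡ false → beyond i x ≡ true → beyond i w ≡ false → 2 ≤ crossings i p
  crosses-twice i p       here      u-out x-in w-out = contradiction (trans (sym u-out) x-in) λ ()
  crosses-twice i (s ∷ p) (there m) u-out x-in w-out with stepEdge T s ≟ i
  ... | yes s≡i = s≤s (crosses-once i p λ v≡w →
        contradiction (trans (sym (trans (step-switches i s s≡i) (cong not u-out))) (trans v≡w w-out)) λ ())
  ... | no  s≢i = crosses-twice i p m (trans (sym (step-stays i s s≢i)) u-out) x-in w-out

module WalkCost {n : ℕ} (T : RootedTree n) where
  open import Data.Fin using (Fin; _≟_)
  open import Data.Rational using (ℚ; _+_; _*_)
  open import Data.Rational.Properties using (*-zeroʳ; *-identityʳ; *-distribˡ-+)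
  open import Relation.Binary.PropositionalEquality
  open NatInℚ using (toℚ; toℚ-+)
  open Sums using (ΣFin-cong; ΣFin-zero; ΣFin-+; ΣFin-single)
  open TreeCrossings T using (crossings)
  open DecidableTests using (⌊⌋-true; ⌊⌋-false)
  open DayCounting using (indicator)
  open import Relation.Nullary.Decidable using (⌊_⌋)
  import Data.Nat as ℕ

  single-step-cost : ∀ (c : Fin n → ℚ) e → ΣFin n (λ i → c i * toℚ (indicator ⌊ e ≟ i ⌋)) ≡ c e
  single-step-cost c e = trans
    (ΣFin-single n _ e (λ i i≢e → trans (cong (λ b → c i * toℚ (indicator b)) (⌊⌋-false (e ≟ i) (i≢e ∘ sym)))
                                        (*-zeroʳ (c i))))
    (trans (cong (λ b → c e * toℚ (indicator b)) (⌊⌋-true (e ≟ e) refl)) (*-identityʳ (c e)))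
    where open import Function using (_∘_)

  crossing-decomposition : ∀ (c : Fin n → ℚ) {u w} (p : Walk T u w) →
    walkCost T c p ≡ ΣFin n (λ i → c i * toℚ (crossings i p))
  crossing-decomposition c []      = sym (ΣFin-zero n (λ i → *-zeroʳ (c i)))
  crossing-decomposition c (s ∷ p) = sym (begin
    ΣFin n (λ i → c i * toℚ (δ i ℕ.+ crossings i p))
      ≡⟨ ΣFin-cong n (λ i → trans (cong (c i *_) (toℚ-+ (δ i) _)) (*-distribˡ-+ (c i) _ _)) ⟩
    ΣFin n (λ i → c i * toℚ (δ i) + c i * toℚ (crossings i p))
      ≡⟨ ΣFin-+ n _ _ ⟩
    ΣFin n (λ i → c i * toℚ (δ i)) + ΣFin n (λ i → c i * toℚ (crossings i p))
      ≡⟨ cong₂ _+_ (single-step-cost c (stepEdge T s)) (sym (crossing-decomposition c p)) ⟩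
    c (stepEdge T s) + walkCost T c p ∎)
    where
    open ≡-Reasoning
    δ : Fin n → ℕ
    δ i = indicator ⌊ stepEdge T s ≟ i ⌋

module FilteredMinimum where
  open import Data.Nat using (ℕ; _⊓_)
  open import Data.Nat.Properties using (⊓-sel)
  open import Data.Bool using (Bool; true; false; if_then_else_)
  open import Data.List using (List; []; _∷_; foldr)
  open import Data.Product using (∃; _×_; _,_)
  open import Data.Sum using (inj₁; inj₂)
  open import Relation.Binary.PropositionalEquality using (_≡_; refl; trans)

  filtered-min-attained : ∀ {A : Set} (P : A → Bool) (τ : A → ℕ) {d} → P d ≡ true → (xs : List A) →
    ∃ λ w → (P w ≡ true) × (foldr (λ j m → if P j then τ j ⊓ m else m) (τ d) xs ≡ τ w)
  filtered-min-attained P τ {d} Pd []       = d , Pd , refl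
  filtered-min-attained P τ     Pd (x ∷ xs) with filtered-min-attained P τ Pd xs
  ... | w , Pw , min≡τw with P x in Px
  ...   | false = w , Pw , min≡τw
  ...   | true  with ⊓-sel (τ x) (foldr (λ j m → if P j then τ j ⊓ m else m) _ xs)
  ...     | inj₁ min≡τx   = x , Px , min≡τx
  ...     | inj₂ min≡rest = w , Pw , trans min≡rest min≡τw

module PeriodBound {n : ℕ} (I : Instance n) (S : Solution I) (feasible : Feasible I S) where
  import Data.Nat as ℕ
  open import Data.Nat.Properties using (*-monoˡ-≤; *-monoʳ-≤)
  open import Data.Nat.Solver using (module +-*-Solver)
  open import Data.Fin using (Fin)
  open import Data.List.Base using (allFin)
  open import Data.Product using (∃; _×_; _,_)
  open import Data.Bool using (true; false)
  open import Data.Rational using (ℚ; _*_; _≤_)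
  open import Data.Rational.Properties using (*-assoc)
  open import Relation.Binary.PropositionalEquality using (_≡_; refl; sym; cong)
  open Instance I
  open Solution S
  open DayCounting
  open NatInℚ
  open Sums
  open TreeCrossings tree
  open WalkCost tree
  open FilteredMinimum

  bottleneck-client : ∀ i → ∃ λ w → (inD tree i w ≡ true) × (ttWeight tree τ i ≡ τ w)
  bottleneck-client i = filtered-min-attained (inD tree i) τ (beyond-self i) (allFin n)

  served-crossings : ∀ i w → inD tree i w ≡ true → ∀ k → 2 ℕ.* indicator (J k w) ℕ.≤ crossings i (T k)
  served-crossings i w w∈D k with J k w in served
  ... | true  = crosses-twice i (T k) (J-on-T k w served) refl w∈D refl
  ... | false = ℕ.z≤n

  traversals : Fin n → ℕ
  traversals i = ΣDaysℕ period (λ k → crossings i (T k))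

  -- 2ℓ ≤ q(e_i) · traversals(e_i), the integral form of 2ℓ/q(e_i) ≤ traversals(e_i).
  traversal-bound : ∀ i → period ℕ.* 2 ℕ.≤ ttWeight tree τ i ℕ.* traversals i
  traversal-bound i with bottleneck-client i
  ... | w , w∈D , q≡τw = begin
    period ℕ.* 2                                          ≤⟨ *-monoˡ-≤ 2 served-often ⟩
    N ℕ.* τ w ℕ.* 2                                       ≡⟨ regroup N (τ w) ⟩
    τ w ℕ.* (2 ℕ.* N)                                     ≡⟨ cong (τ w ℕ.*_) (sym (ΣDaysℕ-scale period 2 _)) ⟩
    τ w ℕ.* ΣDaysℕ period (λ k → 2 ℕ.* indicator (J k w)) ≤⟨ *-monoʳ-≤ (τ w) (ΣDaysℕ-mono period (served-crossings i w w∈D)) ⟩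
    τ w ℕ.* traversals i                                  ≡⟨ cong (ℕ._* traversals i) (sym q≡τw) ⟩
    ttWeight tree τ i ℕ.* traversals i                    ∎
    where
    open Data.Nat.Properties.≤-Reasoning
    N : ℕ
    N = daysWith (λ k → J k w) period
    served-often : period ℕ.≤ N ℕ.* τ w
    served-often = recurrent-periodic-count (τ w) period (λ k → J k w) (λ t → feasible t w) (λ k → J-periodic k w)
    regroup : ∀ a b → a ℕ.* b ℕ.* 2 ≡ b ℕ.* (2 ℕ.* a)
    regroup = solve 2 (λ a b → a :* b :* con 2 := b :* (con 2 :* a)) refl
      where open +-*-Solver

  -- ℓ · L(G,τ) ≤ Σ_{k=1}^{ℓ} c(T_k).  (L(G,τ) is toℚ 2 · Σ_e c(e)/q(e) by
  -- computation, since 2/1 is already in normal form.)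
  period-cost-bound : toℚ period * lowerBound I ≤ ΣDays period (λ k → walkCost tree c (T k))
  period-cost-bound = begin
    toℚ period * (toℚ 2 * Σq)                                          ≡⟨ sym (*-assoc (toℚ period) (toℚ 2) Σq) ⟩
    toℚ period * toℚ 2 * Σq                                            ≡⟨ cong (_* Σq) (sym (toℚ-* period 2)) ⟩
    toℚ (period ℕ.* 2) * Σq                                            ≡⟨ sym (ΣFin-scale n (toℚ (period ℕ.* 2)) _) ⟩
    ΣFin n (λ i → toℚ (period ℕ.* 2) * (c i ÷ℕ ttWeight tree τ i))
      ≤⟨ ΣFin-mono n (λ i → ÷ℕ-bound (c i) (c≥0 i) _ (ttWeight tree τ i) _ (traversal-bound i)) ⟩
    ΣFin n (λ i → c i * toℚ (traversals i))
      ≡⟨ sym (ΣFin-cong n (λ i → ΣDays-toℚ period (c i) _)) ⟩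
    ΣFin n (λ i → ΣDays period (λ k → c i * toℚ (crossings i (T k))))
      ≡⟨ sym (ΣDays-ΣFin period n _) ⟩
    ΣDays period (λ k → ΣFin n (λ i → c i * toℚ (crossings i (T k))))
      ≡⟨ sym (ΣDays-cong period (λ k → crossing-decomposition c (T k))) ⟩
    ΣDays period (λ k → walkCost tree c (T k))                          ∎
    where
    open Data.Rational.Properties.≤-Reasoning
    Σq : ℚ
    Σq = ΣFin n (λ i → c i ÷ℕ ttWeight tree τ i)

open import Data.Rational using (_≤_)

lemma2 : (n : ℕ) (I : Instance n) (S : Solution I) →
    Feasible I S → lowerBound I ≤ averageTourLength I S
lemma2 n I S feasible =
  NatInℚ.divide-bound period ⦃ period≢0 ⦄ (lowerBound I) _ (PeriodBound.period-cost-bound I S feasible)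
  where open Solution S
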